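{- If $n\ge 5$ and $q\ge 1$, then the diameter of $A\Gamma_n^q$ equals $2$.
   Context: $X=\{1,\dots,n\}$, $A_n$ the alternating group on $X$, $\mathcal{E}_n=\{\sigma\in A_n: i^\sigma\neq i \text{ for all } i\in X\}$. $A\Gamma_n$ is the Cayley graph $\Gamma(A_n,\mathcal{E}_n)$ (vertex set $A_n$, edges $\{g,sg\}$, $s\in\mathcal{E}_n$). $A\Gamma_n^q$ is the tensor product of $q$ copies of $A\Gamma_n$: vertex set $A_n^q$, with $(\sigma_1,\dots,\sigma_q)$ adjacent to $(\tau_1,\dots,\tau_q)$ iff $\sigma_k$ is adjacent to $\tau_k$ in $A\Gamma_n$ for every $k$. -}

module Defs where

open import Data.Nat using (ℕ; zero; suc; _≤_; _<_)
open import Data.Nat.Divisibility using (_∣_)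
open import Data.Fin using (Fin) renaming (_<_ to _<ᶠ_)
open import Data.Fin.Properties using () renaming (_<?_ to _<ᶠ?_)
open import Data.Vec using (Vec; lookup; tabulate)
open import Data.List using (List; length; filter; cartesianProduct; allFin)
open import Data.Product using (Σ; ∃-syntax; _×_; _,_; proj₁; proj₂)
open import Data.Sum using (_⊎_)
open import Relation.Nullary using (¬_)
open import Relation.Nullary.Decidable using (_×-dec_)
open import Relation.Binary.PropositionalEquality using (_≡_; _≢_)

-- A map X → X, X = Fin n, represented by its table of values: σ[i] = i^σ.
Map : ℕ → Set
Map n = Vec (Fin n) n

-- σ is a permutation (injective, hence bijective on the finite set Fin n).
IsPerm : ∀ {n} → Map n → Set
IsPerm {n} σ = ∀ (i j : Fin n) → lookup σ i ≡ lookup σ j → i ≡ j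

inversions : ∀ {n} → Map n → ℕ
inversions {n} σ =
  length (filter (λ p → (proj₁ p <ᶠ? proj₂ p) ×-dec (lookup σ (proj₂ p) <ᶠ? lookup σ (proj₁ p)))
                 (cartesianProduct (allFin n) (allFin n)))

IsAlt : ∀ {n} → Map n → Set
IsAlt σ = IsPerm σ × (2 ∣ inversions σ)

IsDerangement : ∀ {n} → Map n → Set
IsDerangement {n} σ = ∀ (i : Fin n) → lookup σ i ≢ i

InE : ∀ {n} → Map n → Set
InE σ = IsAlt σ × IsDerangement σ

-- product s g with right action: i^(s g) = (i^s)^g
_·_ : ∀ {n} → Map n → Map n → Map n
s · g = tabulate (λ i → lookup g (lookup s i))

AGAdj : ∀ {n} → Map n → Map n → Set
AGAdj {n} g h = ∃[ s ] (InE s × (h ≡ s · g ⊎ g ≡ s · h))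

AltTuple : ∀ n q → Vec (Map n) q → Set
AltTuple n q x = ∀ (k : Fin q) → IsAlt (lookup x k)

AGqAdj : ∀ n q → Vec (Map n) q → Vec (Map n) q → Set
AGqAdj n q x y = ∀ (k : Fin q) → AGAdj (lookup x k) (lookup y k)

data Walk {V : Set} (R : V → V → Set) : V → V → ℕ → Set where
  nil  : ∀ {v} → Walk R v v zero
  cons : ∀ {u w v k} → R u w → Walk R w v k → Walk R u v (suc k)

HasDiameter : {V : Set} → (V → Set) → (V → V → Set) → ℕ → Set
HasDiameter {V} P R d =
  (∀ u v → P u → P v → ∃[ k ] (k ≤ d × Walk R u v k)) ×
  (∃[ u ] ∃[ v ] (P u × P v × (∀ k → k < d → ¬ Walk R u v k)))

module Submission where

-- A walk of length two in the tensor power is a walk of length two in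
-- every coordinate, so it suffices to join any σ, τ ∈ A_n by such a walk in AΓ_n.
-- Writing τ = ρ σ, this amounts to factoring ρ ∈ A_n as s₂ s₁ with s₁, s₂ ∈ ℰ_n
-- (the walk is σ, s₁ σ, s₂ s₁ σ).  We take for s₁ an even derangement with
-- s₁(x) ≠ ρ(x) for every x; then s₂ = ρ s₁⁻¹ is again an even derangement.
-- For n ≥ 6 such an s₁ is built by resolving the points x with s(x) = ρ(x) one at a
-- time with a 3-cycle (x y z), where y and z only have to avoid five values; for
-- n = 5 it is found by a finite search among seven 5-cycles.
--
-- Evenness is controlled by the sign homomorphism: the parity of the inversion
-- count is a double sum in the Boolean ring (Bool, xor, ∧), and its additivity under
-- composition reduces to the fact that a symmetric matrix with zero diagonal has
-- even total weight.
--
-- Adjacent vertices of AΓ_n differ at every point, so the even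
-- 3-cycles (0 1 2) and (0 2 1), which differ at 0 but agree at 3, are neither equal
-- nor adjacent; the same then holds for the constant tuples built from them.

open import Defs
open import Algebra.Bundles using (CommutativeRing)
open import Data.Bool using (Bool; true; false; not; _∧_; _xor_; if_then_else_)
open import Data.Bool.Properties
  using (xor-∧-commutativeRing; xor-assoc; xor-same; xor-identityʳ; xor-annihilates-not;
         ∧-distribˡ-xor; ∧-distribʳ-xor; not-involutive)
open import Data.Fin using (Fin; zero; suc; punchOut)
open import Data.Fin.Patterns using (0F; 1F; 2F; 3F; 4F)
open import Data.Fin.Permutation using (Permutation; permutation)
open import Data.Fin.Properties
  using (_≟_; _<?_; <-cmp; <-irrefl; any?; all?; punchOut-injective; injective⇒≤)
import Data.List as List
open List using (List; []; _∷_; _++_; length; filter; cartesianProduct; allFin)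
open import Data.List.Membership.Propositional.Properties using (∈-allFin)
import Data.List.Relation.Unary.All as All
open All using (All; []; _∷_)
import Data.List.Relation.Unary.Any as Any
open import Data.Nat using (ℕ; zero; suc; _*_; _≤_; _<_; s≤s; z≤n)
open import Data.Nat.Divisibility using (_∣_; divides; _∣?_)
open import Data.Nat.Properties using (≤-refl; ≤-trans; <⇒≤; <⇒≱; 1+n≰n; m≤n⇒m<n∨m≡n)
open import Data.Product using (∃; ∃₂; ∃-syntax; _×_; _,_; proj₁; proj₂)
open import Data.Sum using (inj₁; inj₂)
open import Data.Vec using (Vec; []; _∷_; lookup; tabulate; replicate)
open import Data.Vec.Membership.Propositional using (_∈_; _∉_)
open import Data.Vec.Properties
  using (lookup∘tabulate; tabulate∘lookup; tabulate-cong; lookup-replicate)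
import Data.Vec.Relation.Unary.Any as VecAny
open VecAny using (here; there)
open import Data.Vec.Relation.Unary.Any.Properties using (lookup-index)
open import Function using (_∘_; id)
open import Function.Definitions using (Injective)
open import Relation.Binary using (tri<; tri≈; tri>)
open import Relation.Binary.PropositionalEquality
open import Relation.Nullary using (¬_; Dec; yes; no; does; ¬?; contradiction)
open import Relation.Nullary.Decidable
  using (dec-true; dec-false; decidable-stable; _×-dec_; _→-dec_; map′; toWitness)
open import Relation.Unary using (Decidable; _⊆_)

private
  module 𝔹 = CommutativeRing xor-∧-commutativeRing

open import Algebra.Properties.CommutativeMonoid.Sum 𝔹.+-commutativeMonoid
  using (sum-syntax; sum-cong-≗; ∑-distrib-+; ∑-comm; ∑-permute)
open import Algebra.Properties.Group 𝔹.+-group using (x∙y⁻¹≈ε⇒x≈y)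

open ≡-Reasoning

lookup-· : ∀ {n} (s g : Map n) (i : Fin n) → lookup (s · g) i ≡ lookup g (lookup s i)
lookup-· s g = lookup∘tabulate (λ i → lookup g (lookup s i))

map-ext : ∀ {n} {u v : Map n} → (∀ i → lookup u i ≡ lookup v i) → u ≡ v
map-ext {u = u} {v} u≗v =
  trans (sym (tabulate∘lookup u)) (trans (tabulate-cong u≗v) (tabulate∘lookup v))

·-assoc : ∀ {n} (a b c : Map n) → (a · b) · c ≡ a · (b · c)
·-assoc a b c = map-ext λ i → begin
  lookup ((a · b) · c) i            ≡⟨ lookup-· (a · b) c i ⟩
  lookup c (lookup (a · b) i)       ≡⟨ cong (lookup c) (lookup-· a b i) ⟩
  lookup c (lookup b (lookup a i))  ≡⟨ lookup-· b c (lookup a i) ⟨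
  lookup (b · c) (lookup a i)       ≡⟨ lookup-· a (b · c) i ⟨
  lookup (a · (b · c)) i            ∎

perm-· : ∀ {n} (s g : Map n) → IsPerm s → IsPerm g → IsPerm (s · g)
perm-· s g s-perm g-perm i j eq =
  s-perm i j (g-perm _ _ (trans (sym (lookup-· s g i)) (trans eq (lookup-· s g j))))

perm-cancelʳ : ∀ {n} (s g : Map n) → IsPerm (s · g) → IsPerm s
perm-cancelʳ s g sg-perm i j eq =
  sg-perm i j (trans (lookup-· s g i) (trans (cong (lookup g) eq) (sym (lookup-· s g j))))

-- An injective endomap of Fin n is onto: a missed value y could be punched out,
-- giving an injection Fin (suc m) → Fin m.
injective⇒surjective : ∀ {n} {f : Fin n → Fin n} → Injective _≡_ _≡_ f →
                       ∀ y → ∃ λ x → f x ≡ y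
injective⇒surjective {suc m} {f} f-inj y with any? (λ x → f x ≟ y)
... | yes hit   = hit
... | no missed = contradiction (injective⇒≤ {f = squeeze} squeeze-injective) 1+n≰n
  where
  avoided : ∀ x → y ≢ f x
  avoided x y≡fx = missed (x , sym y≡fx)
  squeeze : Fin (suc m) → Fin m
  squeeze x = punchOut (avoided x)
  squeeze-injective : Injective _≡_ _≡_ squeeze
  squeeze-injective {a} {b} eq = f-inj (punchOut-injective (avoided a) (avoided b) eq)

injective⇒permutation : ∀ {n} {f : Fin n → Fin n} → Injective _≡_ _≡_ f → Permutation n n
injective⇒permutation {f = f} f-inj =
  permutation f (proj₁ ∘ onto) (proj₂ ∘ onto) (λ x → f-inj (proj₂ (onto (f x))))
  where onto = injective⇒surjective f-inj

preimage : ∀ {n} (σ : Map n) → IsPerm σ → Fin n → Fin n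
preimage σ σ-perm y = proj₁ (injective⇒surjective (σ-perm _ _) y)

preimage-inverse : ∀ {n} (σ : Map n) (σ-perm : IsPerm σ) y → lookup σ (preimage σ σ-perm y) ≡ y
preimage-inverse σ σ-perm y = proj₂ (injective⇒surjective (σ-perm _ _) y)

preimage-unique : ∀ {n} (σ : Map n) (σ-perm : IsPerm σ) {x y} →
                  lookup σ x ≡ y → x ≡ preimage σ σ-perm y
preimage-unique σ σ-perm eq = σ-perm _ _ (trans eq (sym (preimage-inverse σ σ-perm _)))

divide : ∀ {n} (ρ g : Map n) → IsPerm g → Map n
divide ρ g g-perm = tabulate (λ i → preimage g g-perm (lookup ρ i))

divide-· : ∀ {n} (ρ g : Map n) (g-perm : IsPerm g) → divide ρ g g-perm · g ≡ ρ
divide-· ρ g g-perm = map-ext λ i → begin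
  lookup (divide ρ g g-perm · g) i           ≡⟨ lookup-· (divide ρ g g-perm) g i ⟩
  lookup g (lookup (divide ρ g g-perm) i)    ≡⟨ cong (lookup g) (lookup∘tabulate _ i) ⟩
  lookup g (preimage g g-perm (lookup ρ i))  ≡⟨ preimage-inverse g g-perm (lookup ρ i) ⟩
  lookup ρ i                                 ∎

identity : ∀ {n} → Map n
identity = tabulate id

lookup-identity : ∀ {n} (i : Fin n) → lookup identity i ≡ i
lookup-identity = lookup∘tabulate id

identity-perm : ∀ {n} → IsPerm (identity {n})
identity-perm i j eq = trans (sym (lookup-identity i)) (trans eq (lookup-identity j))

identity-square : ∀ {n} → identity · identity ≡ identity {n}
identity-square = map-ext λ i → trans (lookup-· identity identity i) (lookup-identity _)

_<ᵇ_ : ∀ {n} → Fin n → Fin n → Bool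
i <ᵇ j = does (i <? j)

<ᵇ-irrefl : ∀ {n} (i : Fin n) → i <ᵇ i ≡ false
<ᵇ-irrefl i = dec-false (i <? i) (<-irrefl refl)

<ᵇ⇒≢ : ∀ {n} {i j : Fin n} → i <ᵇ j ≡ true → i ≢ j
<ᵇ⇒≢ {i = i} i<j refl with () ← trans (sym i<j) (<ᵇ-irrefl i)

<ᵇ-flip : ∀ {n} {i j : Fin n} → i ≢ j → j <ᵇ i ≡ not (i <ᵇ j)
<ᵇ-flip {i = i} {j} i≢j with <-cmp i j
... | tri< i<j _ j≮i = trans (dec-false (j <? i) j≮i) (cong not (sym (dec-true (i <? j) i<j)))
... | tri≈ _ i≡j _   = contradiction i≡j i≢j
... | tri> i≮j _ j<i = trans (dec-true (j <? i) j<i) (cong not (sym (dec-false (i <? j) i≮j)))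

∑∑ : ∀ {n} → (Fin n → Fin n → Bool) → Bool
∑∑ {n} W = ∑[ i < n ] ∑[ j < n ] W i j

∑∑-cong : ∀ {n} {V W : Fin n → Fin n → Bool} → (∀ i j → V i j ≡ W i j) → ∑∑ V ≡ ∑∑ W
∑∑-cong V≗W = sum-cong-≗ (λ i → sum-cong-≗ (V≗W i))

∑∑-xor : ∀ {n} (V W : Fin n → Fin n → Bool) → ∑∑ (λ i j → V i j xor W i j) ≡ ∑∑ V xor ∑∑ W
∑∑-xor {n} V W = trans (sum-cong-≗ (λ i → ∑-distrib-+ (V i) (W i)))
                       (∑-distrib-+ (λ i → ∑[ j < n ] V i j) (λ i → ∑[ j < n ] W i j))

∑∑-reindex : ∀ {n} {f : Fin n → Fin n} → Injective _≡_ _≡_ f →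
             (F : Fin n → Fin n → Bool) → ∑∑ (λ i j → F (f i) (f j)) ≡ ∑∑ F
∑∑-reindex {n} {f} f-inj F = sym (trans (∑-permute (λ a → ∑[ b < n ] F a b) π)
                                        (sum-cong-≗ (λ i → ∑-permute (F (f i)) π)))
  where π = injective⇒permutation f-inj

pairSum : ∀ {n} → (Fin n → Fin n → Bool) → Bool
pairSum W = ∑∑ (λ i j → i <ᵇ j ∧ W i j)

pairSum-xor : ∀ {n} (V W : Fin n → Fin n → Bool) →
              pairSum (λ i j → V i j xor W i j) ≡ pairSum V xor pairSum W
pairSum-xor V W = trans (∑∑-cong (λ i j → ∧-distribˡ-xor (i <ᵇ j) (V i j) (W i j)))
                        (∑∑-xor (λ i j → i <ᵇ j ∧ V i j) (λ i j → i <ᵇ j ∧ W i j))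

Symmetric : ∀ {n} → (Fin n → Fin n → Bool) → Set
Symmetric W = ∀ i j → W j i ≡ W i j

ZeroDiagonal : ∀ {n} → (Fin n → Fin n → Bool) → Set
ZeroDiagonal W = ∀ i → W i i ≡ false

-- A symmetric matrix with zero diagonal has even weight: the entries above and
-- below the diagonal contribute the same pair sum.
symmetric-sum : ∀ {n} (W : Fin n → Fin n → Bool) → Symmetric W → ZeroDiagonal W → ∑∑ W ≡ false
symmetric-sum W W-sym W-diag = begin
  ∑∑ W
    ≡⟨ ∑∑-cong split ⟩
  ∑∑ (λ i j → (i <ᵇ j ∧ W i j) xor (j <ᵇ i ∧ W i j))
    ≡⟨ ∑∑-xor (λ i j → i <ᵇ j ∧ W i j) (λ i j → j <ᵇ i ∧ W i j) ⟩
  pairSum W xor ∑∑ (λ i j → j <ᵇ i ∧ W i j)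
    ≡⟨ cong (pairSum W xor_) below≡above ⟩
  pairSum W xor pairSum W
    ≡⟨ xor-same (pairSum W) ⟩
  false
    ∎
  where
  split : ∀ i j → W i j ≡ (i <ᵇ j ∧ W i j) xor (j <ᵇ i ∧ W i j)
  split i j with i ≟ j
  ... | yes refl = trans (W-diag i) (sym (xor-same (i <ᵇ i ∧ W i i)))
  ... | no i≢j rewrite <ᵇ-flip i≢j = by-cases (i <ᵇ j)
    where
    by-cases : ∀ a → W i j ≡ (a ∧ W i j) xor (not a ∧ W i j)
    by-cases true  = sym (xor-identityʳ (W i j))
    by-cases false = refl
  -- swapping the summation order turns the lower triangle into the upper one
  below≡above : ∑∑ (λ i j → j <ᵇ i ∧ W i j) ≡ pairSum W
  below≡above = trans (∑-comm (λ i j → j <ᵇ i ∧ W i j))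
                      (∑∑-cong (λ i j → cong (i <ᵇ j ∧_) (W-sym i j)))

reversal : ∀ {n} → (Fin n → Fin n) → Fin n → Fin n → Bool
reversal f i j = i <ᵇ j xor f i <ᵇ f j

reversal-diagonal : ∀ {n} (f : Fin n → Fin n) → ZeroDiagonal (reversal f)
reversal-diagonal f i = cong₂ _xor_ (<ᵇ-irrefl i) (<ᵇ-irrefl (f i))

reversal-symmetric : ∀ {n} {f : Fin n → Fin n} → Injective _≡_ _≡_ f → Symmetric (reversal f)
reversal-symmetric {f = f} f-inj i j with i ≟ j
... | yes refl = refl
... | no i≢j   = trans (cong₂ _xor_ (<ᵇ-flip i≢j) (<ᵇ-flip (i≢j ∘ f-inj)))
                       (xor-annihilates-not (i <ᵇ j) (f i <ᵇ f j))

reversal-∘ : ∀ {n} (f g : Fin n → Fin n) i j →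
             reversal (g ∘ f) i j ≡ reversal f i j xor reversal g (f i) (f j)
reversal-∘ f g i j = sym (begin
  (a xor b) xor (b xor c)  ≡⟨ xor-assoc a b (b xor c) ⟩
  a xor (b xor (b xor c))  ≡⟨ cong (a xor_) (xor-assoc b b c) ⟨
  a xor ((b xor b) xor c)  ≡⟨ cong (λ t → a xor (t xor c)) (xor-same b) ⟩
  a xor c                  ∎)
  where
  a = i <ᵇ j
  b = f i <ᵇ f j
  c = g (f i) <ᵇ g (f j)

-- For symmetric W with zero diagonal, summing over the pairs i < j or over the pairs
-- with f i < f j gives the same result: the two index sets differ by the pairs that f
-- reverses, which carry a symmetric zero-diagonal matrix.
pairSum-reorder : ∀ {n} {f : Fin n → Fin n} → Injective _≡_ _≡_ f →
                  (W : Fin n → Fin n → Bool) → Symmetric W → ZeroDiagonal W →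
                  pairSum W ≡ ∑∑ (λ i j → f i <ᵇ f j ∧ W i j)
pairSum-reorder {f = f} f-inj W W-sym W-diag = x∙y⁻¹≈ε⇒x≈y _ _ (begin
  pairSum W xor ∑∑ (λ i j → f i <ᵇ f j ∧ W i j)
    ≡⟨ ∑∑-xor (λ i j → i <ᵇ j ∧ W i j) (λ i j → f i <ᵇ f j ∧ W i j) ⟨
  ∑∑ (λ i j → (i <ᵇ j ∧ W i j) xor (f i <ᵇ f j ∧ W i j))
    ≡⟨ ∑∑-cong (λ i j → ∧-distribʳ-xor (W i j) (i <ᵇ j) (f i <ᵇ f j)) ⟨
  ∑∑ (λ i j → reversal f i j ∧ W i j)
    ≡⟨ symmetric-sum _ reversed-symmetric reversed-diagonal ⟩
  false
    ∎)
  where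
  reversed-symmetric : Symmetric (λ i j → reversal f i j ∧ W i j)
  reversed-symmetric i j = cong₂ _∧_ (reversal-symmetric f-inj i j) (W-sym i j)
  reversed-diagonal : ZeroDiagonal (λ i j → reversal f i j ∧ W i j)
  reversed-diagonal i = cong (_∧ W i i) (reversal-diagonal f i)

inversionParity : ∀ {n} → (Fin n → Fin n) → Bool
inversionParity f = ∑∑ (λ i j → i <ᵇ j ∧ f j <ᵇ f i)

inversionParity-cong : ∀ {n} {f g : Fin n → Fin n} → (∀ i → f i ≡ g i) →
                       inversionParity f ≡ inversionParity g
inversionParity-cong f≗g = ∑∑-cong (λ i j → cong₂ (λ a b → i <ᵇ j ∧ a <ᵇ b) (f≗g j) (f≗g i))

inversionParity≡pairSum : ∀ {n} {f : Fin n → Fin n} → Injective _≡_ _≡_ f →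
                          inversionParity f ≡ pairSum (reversal f)
inversionParity≡pairSum {f = f} f-inj = ∑∑-cong inversion
  where
  inversion : ∀ i j → i <ᵇ j ∧ f j <ᵇ f i ≡ i <ᵇ j ∧ reversal f i j
  inversion i j with i <ᵇ j in i<j
  ... | true  = <ᵇ-flip (<ᵇ⇒≢ i<j ∘ f-inj)
  ... | false = refl

inversionParity-∘ : ∀ {n} {f g : Fin n → Fin n} → Injective _≡_ _≡_ f → Injective _≡_ _≡_ g →
                    inversionParity (g ∘ f) ≡ inversionParity f xor inversionParity g
inversionParity-∘ {f = f} {g} f-inj g-inj = begin
  inversionParity (g ∘ f)
    ≡⟨ inversionParity≡pairSum (f-inj ∘ g-inj) ⟩
  pairSum (reversal (g ∘ f))
    ≡⟨ ∑∑-cong (λ i j → cong (i <ᵇ j ∧_) (reversal-∘ f g i j)) ⟩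
  pairSum (λ i j → reversal f i j xor reversal g (f i) (f j))
    ≡⟨ pairSum-xor (reversal f) (λ i j → reversal g (f i) (f j)) ⟩
  pairSum (reversal f) xor pairSum (λ i j → reversal g (f i) (f j))
    ≡⟨ cong (pairSum (reversal f) xor_) (pairSum-reorder f-inj (λ i j → reversal g (f i) (f j))
          (λ i j → reversal-symmetric g-inj (f i) (f j)) (λ i → reversal-diagonal g (f i))) ⟩
  pairSum (reversal f) xor ∑∑ (λ i j → f i <ᵇ f j ∧ reversal g (f i) (f j))
    ≡⟨ cong (pairSum (reversal f) xor_) (∑∑-reindex f-inj (λ a b → a <ᵇ b ∧ reversal g a b)) ⟩
  pairSum (reversal f) xor pairSum (reversal g)
    ≡⟨ cong₂ _xor_ (inversionParity≡pairSum f-inj) (inversionParity≡pairSum g-inj) ⟨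
  inversionParity f xor inversionParity g
    ∎

isOdd : ℕ → Bool
isOdd zero    = false
isOdd (suc m) = not (isOdd m)

2∣⇒even : ∀ m → 2 ∣ m → isOdd m ≡ false
2∣⇒even _ (divides q refl) = twice q
  where
  twice : ∀ q → isOdd (q * 2) ≡ false
  twice zero    = refl
  twice (suc q) = trans (not-involutive _) (twice q)

even⇒2∣ : ∀ m → isOdd m ≡ false → 2 ∣ m
even⇒2∣ zero          _    = divides 0 refl
even⇒2∣ (suc (suc m)) even with divides q m≡q*2 ← even⇒2∣ m (trans (sym (not-involutive _)) even)
  = divides (suc q) (cong (λ t → suc (suc t)) m≡q*2)

xorList : ∀ {A : Set} → (A → Bool) → List A → Bool
xorList f []       = false
xorList f (x ∷ xs) = f x xor xorList f xs

isOdd-filter : ∀ {A : Set} {P : A → Set} (P? : Decidable P) (xs : List A) →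
               isOdd (length (filter P? xs)) ≡ xorList (does ∘ P?) xs
isOdd-filter P? []       = refl
isOdd-filter P? (x ∷ xs) with does (P? x)
... | true  = cong not (isOdd-filter P? xs)
... | false = isOdd-filter P? xs

xorList-++ : ∀ {A : Set} (f : A → Bool) (xs ys : List A) →
             xorList f (xs ++ ys) ≡ xorList f xs xor xorList f ys
xorList-++ f []       ys = refl
xorList-++ f (x ∷ xs) ys =
  trans (cong (f x xor_) (xorList-++ f xs ys)) (sym (xor-assoc (f x) (xorList f xs) (xorList f ys)))

xorList-map : ∀ {A B : Set} (f : B → Bool) (g : A → B) (xs : List A) →
              xorList f (List.map g xs) ≡ xorList (f ∘ g) xs
xorList-map f g []       = refl
xorList-map f g (x ∷ xs) = cong (f (g x) xor_) (xorList-map f g xs)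

xorList-cartesianProduct : ∀ {A B : Set} (f : A × B → Bool) (xs : List A) (ys : List B) →
  xorList f (cartesianProduct xs ys) ≡ xorList (λ x → xorList (λ y → f (x , y)) ys) xs
xorList-cartesianProduct f []       ys = refl
xorList-cartesianProduct f (x ∷ xs) ys =
  trans (xorList-++ f (List.map (x ,_) ys) (cartesianProduct xs ys))
        (cong₂ _xor_ (xorList-map f (x ,_) ys) (xorList-cartesianProduct f xs ys))

xorList-tabulate : ∀ {A : Set} {n} (f : A → Bool) (g : Fin n → A) →
                   xorList f (List.tabulate g) ≡ ∑[ i < n ] f (g i)
xorList-tabulate {n = zero}  f g = refl
xorList-tabulate {n = suc n} f g = cong (f (g zero) xor_) (xorList-tabulate f (g ∘ suc))

isOdd-inversions : ∀ {n} (σ : Map n) → isOdd (inversions σ) ≡ inversionParity (lookup σ)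
isOdd-inversions {n} σ = begin
  isOdd (inversions σ)
    ≡⟨ isOdd-filter _ (cartesianProduct (allFin n) (allFin n)) ⟩
  xorList inverted (cartesianProduct (allFin n) (allFin n))
    ≡⟨ xorList-cartesianProduct inverted (allFin n) (allFin n) ⟩
  xorList (λ i → xorList (λ j → inverted (i , j)) (allFin n)) (allFin n)
    ≡⟨ xorList-tabulate (λ i → xorList (λ j → inverted (i , j)) (allFin n)) id ⟩
  ∑[ i < n ] xorList (λ j → inverted (i , j)) (allFin n)
    ≡⟨ sum-cong-≗ (λ i → xorList-tabulate (λ j → inverted (i , j)) id) ⟩
  inversionParity (lookup σ)
    ∎
  where
  inverted : Fin n × Fin n → Bool
  inverted p = proj₁ p <ᵇ proj₂ p ∧ lookup σ (proj₂ p) <ᵇ lookup σ (proj₁ p)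

-- The sign of a map (false = even).
sign : ∀ {n} → Map n → Bool
sign σ = inversionParity (lookup σ)

alt⇒sign : ∀ {n} (σ : Map n) → IsAlt σ → sign σ ≡ false
alt⇒sign σ (_ , 2∣inversions) = trans (sym (isOdd-inversions σ)) (2∣⇒even _ 2∣inversions)

sign⇒alt : ∀ {n} (σ : Map n) → IsPerm σ → sign σ ≡ false → IsAlt σ
sign⇒alt σ σ-perm even = σ-perm , even⇒2∣ _ (trans (isOdd-inversions σ) even)

sign-· : ∀ {n} (s g : Map n) → IsPerm s → IsPerm g → sign (s · g) ≡ sign s xor sign g
sign-· s g s-perm g-perm =
  trans (inversionParity-cong (lookup-· s g)) (inversionParity-∘ (s-perm _ _) (g-perm _ _))

alt-· : ∀ {n} (s g : Map n) → IsAlt s → IsAlt g → IsAlt (s · g)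
alt-· s g s-alt@(s-perm , _) g-alt@(g-perm , _) =
  sign⇒alt (s · g) (perm-· s g s-perm g-perm) (begin
    sign (s · g)       ≡⟨ sign-· s g s-perm g-perm ⟩
    sign s xor sign g  ≡⟨ cong₂ _xor_ (alt⇒sign s s-alt) (alt⇒sign g g-alt) ⟩
    false              ∎)

alt-square : ∀ {n} (s : Map n) → IsPerm s → IsAlt (s · s)
alt-square s s-perm =
  sign⇒alt (s · s) (perm-· s s s-perm s-perm) (trans (sign-· s s s-perm s-perm) (xor-same (sign s)))

alt-cancelʳ : ∀ {n} (s g : Map n) → IsAlt g → IsAlt (s · g) → IsAlt s
alt-cancelʳ s g g-alt@(g-perm , _) sg-alt@(sg-perm , _) =
  sign⇒alt s s-perm (begin
    sign s             ≡⟨ xor-identityʳ (sign s) ⟨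
    sign s xor false   ≡⟨ cong (sign s xor_) (alt⇒sign g g-alt) ⟨
    sign s xor sign g  ≡⟨ sign-· s g s-perm g-perm ⟨
    sign (s · g)       ≡⟨ alt⇒sign (s · g) sg-alt ⟩
    false              ∎)
  where
  s-perm = perm-cancelʳ s g sg-perm

identity-alt : ∀ {n} → IsAlt (identity {n})
identity-alt = subst IsAlt identity-square (alt-square identity identity-perm)

cycle3 : ∀ {n} → Fin n → Fin n → Fin n → Fin n → Fin n
cycle3 x y z w =
  if does (w ≟ x) then y else if does (w ≟ y) then z else if does (w ≟ z) then x else w

cycle3-x : ∀ {n} (x y z : Fin n) → cycle3 x y z x ≡ y
cycle3-x x y z rewrite dec-true (x ≟ x) refl = refl

cycle3-y : ∀ {n} (x y z : Fin n) → y ≢ x → cycle3 x y z y ≡ z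
cycle3-y x y z y≢x rewrite dec-false (y ≟ x) y≢x | dec-true (y ≟ y) refl = refl

cycle3-z : ∀ {n} (x y z : Fin n) → z ≢ x → z ≢ y → cycle3 x y z z ≡ x
cycle3-z x y z z≢x z≢y
  rewrite dec-false (z ≟ x) z≢x | dec-false (z ≟ y) z≢y | dec-true (z ≟ z) refl = refl

cycle3-elsewhere : ∀ {n} (x y z w : Fin n) → w ≢ x → w ≢ y → w ≢ z → cycle3 x y z w ≡ w
cycle3-elsewhere x y z w w≢x w≢y w≢z
  rewrite dec-false (w ≟ x) w≢x | dec-false (w ≟ y) w≢y | dec-false (w ≟ z) w≢z = refl

data Position {n} (x y z w : Fin n) : Set where
  at-x      : w ≡ x → Position x y z w
  at-y      : w ≡ y → Position x y z w
  at-z      : w ≡ z → Position x y z w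
  elsewhere : w ≢ x → w ≢ y → w ≢ z → Position x y z w

position : ∀ {n} (x y z w : Fin n) → Position x y z w
position x y z w with w ≟ x | w ≟ y | w ≟ z
... | yes w≡x | _       | _       = at-x w≡x
... | no _    | yes w≡y | _       = at-y w≡y
... | no _    | no _    | yes w≡z = at-z w≡z
... | no w≢x  | no w≢y  | no w≢z  = elsewhere w≢x w≢y w≢z

Distinct : ∀ {n} → Fin n → Fin n → Fin n → Set
Distinct x y z = x ≢ y × y ≢ z × z ≢ x

distinct-swap : ∀ {n} {x y z : Fin n} → Distinct x y z → Distinct x z y
distinct-swap (x≢y , y≢z , z≢x) = ≢-sym z≢x , ≢-sym y≢z , ≢-sym x≢y

cycle3-inverse : ∀ {n} {x y z : Fin n} → Distinct x y z → ∀ w → cycle3 x z y (cycle3 x y z w) ≡ w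
cycle3-inverse {x = x} {y} {z} (x≢y , y≢z , z≢x) w with position x y z w
... | at-x refl = trans (cong (cycle3 x z y) (cycle3-x x y z)) (cycle3-z x z y (≢-sym x≢y) y≢z)
... | at-y refl = trans (cong (cycle3 x z y) (cycle3-y x y z (≢-sym x≢y))) (cycle3-y x z y z≢x)
... | at-z refl = trans (cong (cycle3 x z y) (cycle3-z x y z z≢x (≢-sym y≢z))) (cycle3-x x z y)
... | elsewhere w≢x w≢y w≢z =
  trans (cong (cycle3 x z y) (cycle3-elsewhere x y z w w≢x w≢y w≢z))
        (cycle3-elsewhere x z y w w≢x w≢z w≢y)

cycle3-twice : ∀ {n} {x y z : Fin n} → Distinct x y z → ∀ w →
               cycle3 x y z (cycle3 x y z w) ≡ cycle3 x z y w
cycle3-twice {x = x} {y} {z} (x≢y , y≢z , z≢x) w with position x y z w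
... | at-x refl = begin
  cycle3 x y z (cycle3 x y z x)  ≡⟨ cong (cycle3 x y z) (cycle3-x x y z) ⟩
  cycle3 x y z y                 ≡⟨ cycle3-y x y z (≢-sym x≢y) ⟩
  z                              ≡⟨ cycle3-x x z y ⟨
  cycle3 x z y x                 ∎
... | at-y refl = begin
  cycle3 x y z (cycle3 x y z y)  ≡⟨ cong (cycle3 x y z) (cycle3-y x y z (≢-sym x≢y)) ⟩
  cycle3 x y z z                 ≡⟨ cycle3-z x y z z≢x (≢-sym y≢z) ⟩
  x                              ≡⟨ cycle3-z x z y (≢-sym x≢y) y≢z ⟨
  cycle3 x z y y                 ∎
... | at-z refl = begin
  cycle3 x y z (cycle3 x y z z)  ≡⟨ cong (cycle3 x y z) (cycle3-z x y z z≢x (≢-sym y≢z)) ⟩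
  cycle3 x y z x                 ≡⟨ cycle3-x x y z ⟩
  y                              ≡⟨ cycle3-y x z y z≢x ⟨
  cycle3 x z y z                 ∎
... | elsewhere w≢x w≢y w≢z = begin
  cycle3 x y z (cycle3 x y z w)  ≡⟨ cong (cycle3 x y z) (cycle3-elsewhere x y z w w≢x w≢y w≢z) ⟩
  cycle3 x y z w                 ≡⟨ cycle3-elsewhere x y z w w≢x w≢y w≢z ⟩
  w                              ≡⟨ cycle3-elsewhere x z y w w≢x w≢z w≢y ⟨
  cycle3 x z y w                 ∎

threeCycle : ∀ {n} → Fin n → Fin n → Fin n → Map n
threeCycle x y z = tabulate (cycle3 x y z)

threeCycle-perm : ∀ {n} (x y z : Fin n) → Distinct x y z → IsPerm (threeCycle x y z)
threeCycle-perm x y z xyz a b eq = begin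
  a                              ≡⟨ cycle3-inverse xyz a ⟨
  cycle3 x z y (cycle3 x y z a)  ≡⟨ cong (cycle3 x z y) same-value ⟩
  cycle3 x z y (cycle3 x y z b)  ≡⟨ cycle3-inverse xyz b ⟩
  b                              ∎
  where
  same-value : cycle3 x y z a ≡ cycle3 x y z b
  same-value = trans (sym (lookup∘tabulate _ a)) (trans eq (lookup∘tabulate _ b))

-- A 3-cycle is even, being the square of the inverse 3-cycle.
threeCycle-alt : ∀ {n} (x y z : Fin n) → Distinct x y z → IsAlt (threeCycle x y z)
threeCycle-alt x y z xyz =
  subst IsAlt square (alt-square (threeCycle x z y) (threeCycle-perm x z y (distinct-swap xyz)))
  where
  square : threeCycle x z y · threeCycle x z y ≡ threeCycle x y z
  square = map-ext λ w → begin
    lookup (threeCycle x z y · threeCycle x z y) w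
      ≡⟨ lookup-· (threeCycle x z y) (threeCycle x z y) w ⟩
    lookup (threeCycle x z y) (lookup (threeCycle x z y) w)
      ≡⟨ lookup∘tabulate (cycle3 x z y) (lookup (threeCycle x z y) w) ⟩
    cycle3 x z y (lookup (threeCycle x z y) w)
      ≡⟨ cong (cycle3 x z y) (lookup∘tabulate (cycle3 x z y) w) ⟩
    cycle3 x z y (cycle3 x z y w)
      ≡⟨ cycle3-twice (distinct-swap xyz) w ⟩
    cycle3 x y z w
      ≡⟨ lookup∘tabulate (cycle3 x y z) w ⟨
    lookup (threeCycle x y z) w
      ∎

-- Fewer than n forbidden values leave a point of Fin n free: otherwise the position
-- of each point in the list of forbidden values would inject Fin n into Fin k.
fresh : ∀ {n k} (forbidden : Vec (Fin n) k) → k < n → ∃ λ w → w ∉ forbidden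
fresh {n} {k} forbidden k<n with any? (λ w → ¬? (VecAny.any? (w ≟_) forbidden))
... | yes found = found
... | no none   = contradiction (injective⇒≤ {f = slot} slot-injective) (<⇒≱ k<n)
  where
  covered : ∀ w → w ∈ forbidden
  covered w = decidable-stable (VecAny.any? (w ≟_) forbidden) (λ w∉ → none (w , w∉))
  slot : Fin n → Fin k
  slot w = VecAny.index (covered w)
  slot-injective : Injective _≡_ _≡_ slot
  slot-injective {a} {b} eq =
    trans (lookup-index (covered a))
          (trans (cong (lookup forbidden) eq) (sym (lookup-index (covered b))))

Collision : ∀ {n} → Map n → Map n → Fin n → Set
Collision ρ s x = lookup s x ≡ lookup ρ x

FixedPoint : ∀ {n} → Map n → Fin n → Set
FixedPoint s x = lookup s x ≡ x

Avoids : ∀ {n} → Map n → Map n → Set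
Avoids ρ s = ∀ x → ¬ Collision ρ s x

avoids-identity⇒derangement : ∀ {n} (d : Map n) → Avoids identity d → IsDerangement d
avoids-identity⇒derangement d d-avoids i fixed = d-avoids i (trans fixed (sym (lookup-identity i)))

record Repair {n} (ρ s : Map n) (x : Fin n) : Set where
  field
    repaired           : Map n
    repaired-alt       : IsAlt repaired
    no-new-fixedPoints : FixedPoint repaired ⊆ FixedPoint s
    no-new-collisions  : Collision ρ repaired ⊆ Collision ρ s
    resolved           : ¬ Collision ρ repaired x

-- Precomposing with the 3-cycle (x y z) gives the values s y, s z, s x = ρ x at x, y, z
-- and changes nothing else; the side conditions make this a repair at x.
repair-with : ∀ {n} (ρ s : Map n) (x y z : Fin n) → IsPerm ρ → IsAlt s → Collision ρ s x →
  y ≢ x → lookup s y ≢ x → z ≢ x → z ≢ y → z ≢ lookup ρ x →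
  lookup s z ≢ y → lookup s z ≢ lookup ρ y → Repair ρ s x
repair-with ρ s x y z ρ-perm s-alt@(s-perm , _) sx≡ρx y≢x sy≢x z≢x z≢y z≢ρx sz≢y sz≢ρy =
  record
    { repaired           = s′
    ; repaired-alt       = alt-· (threeCycle x y z) s
                             (threeCycle-alt x y z (≢-sym y≢x , ≢-sym z≢y , z≢x)) s-alt
    ; no-new-fixedPoints = no-new-fixedPoints
    ; no-new-collisions  = no-new-collisions
    ; resolved           = resolved
    }
  where
  s′ : Map _
  s′ = threeCycle x y z · s
  value : ∀ w → lookup s′ w ≡ lookup s (cycle3 x y z w)
  value w = trans (lookup-· (threeCycle x y z) s w)
                  (cong (lookup s) (lookup∘tabulate (cycle3 x y z) w))
  value-x : lookup s′ x ≡ lookup s y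
  value-x = trans (value x) (cong (lookup s) (cycle3-x x y z))
  value-y : lookup s′ y ≡ lookup s z
  value-y = trans (value y) (cong (lookup s) (cycle3-y x y z y≢x))
  value-z : lookup s′ z ≡ lookup ρ x
  value-z = trans (value z) (trans (cong (lookup s) (cycle3-z x y z z≢x z≢y)) sx≡ρx)
  value-elsewhere : ∀ {w} → w ≢ x → w ≢ y → w ≢ z → lookup s′ w ≡ lookup s w
  value-elsewhere {w} w≢x w≢y w≢z =
    trans (value w) (cong (lookup s) (cycle3-elsewhere x y z w w≢x w≢y w≢z))
  resolved : ¬ Collision ρ s′ x
  resolved collides = y≢x (s-perm y x (trans (sym value-x) (trans collides (sym sx≡ρx))))
  no-new-fixedPoints : FixedPoint s′ ⊆ FixedPoint s
  no-new-fixedPoints {w} fixed with position x y z w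
  ... | at-x refl = contradiction (trans (sym value-x) fixed) sy≢x
  ... | at-y refl = contradiction (trans (sym value-y) fixed) sz≢y
  ... | at-z refl = contradiction (sym (trans (sym value-z) fixed)) z≢ρx
  ... | elsewhere w≢x w≢y w≢z = trans (sym (value-elsewhere w≢x w≢y w≢z)) fixed
  no-new-collisions : Collision ρ s′ ⊆ Collision ρ s
  no-new-collisions {w} collides with position x y z w
  ... | at-x refl = contradiction collides resolved
  ... | at-y refl = contradiction (trans (sym value-y) collides) sz≢ρy
  ... | at-z refl = contradiction (sym (ρ-perm x z (trans (sym value-z) collides))) z≢x
  ... | elsewhere w≢x w≢y w≢z = trans (sym (value-elsewhere w≢x w≢y w≢z)) collides

-- For n ≥ 6 the side conditions can be met: y avoids x and s⁻¹ x, and then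
-- z avoids x, y, ρ x, s⁻¹ y and s⁻¹ (ρ y).
repair : ∀ {n} (ρ s : Map n) (x : Fin n) → 6 ≤ n → IsPerm ρ → IsAlt s → Collision ρ s x →
         Repair ρ s x
repair ρ s x n≥6 ρ-perm s-alt@(s-perm , _) collision
  with y , y∉ ← fresh (x ∷ preimage s s-perm x ∷ []) (≤-trans (s≤s (s≤s (s≤s z≤n))) n≥6)
  with z , z∉ ← fresh (x ∷ y ∷ lookup ρ x ∷ preimage s s-perm y
                         ∷ preimage s s-perm (lookup ρ y) ∷ []) n≥6
  = repair-with ρ s x y z ρ-perm s-alt collision
      (y∉ ∘ here) (y∉ ∘ there ∘ here ∘ preimage-unique s s-perm)
      (z∉ ∘ here) (z∉ ∘ there ∘ here) (z∉ ∘ there ∘ there ∘ here)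
      (z∉ ∘ there ∘ there ∘ there ∘ here ∘ preimage-unique s s-perm)
      (z∉ ∘ there ∘ there ∘ there ∘ there ∘ here ∘ preimage-unique s s-perm)

remove-collisions : ∀ {n} (ρ s₀ : Map n) → 6 ≤ n → IsPerm ρ → IsAlt s₀ → (xs : List (Fin n)) →
  ∃ λ s → IsAlt s × FixedPoint s ⊆ FixedPoint s₀ × All (¬_ ∘ Collision ρ s) xs
remove-collisions ρ s₀ n≥6 ρ-perm s₀-alt [] = s₀ , s₀-alt , id , []
remove-collisions ρ s₀ n≥6 ρ-perm s₀-alt (x ∷ xs)
  with s , s-alt , s-fixed , s-fine ← remove-collisions ρ s₀ n≥6 ρ-perm s₀-alt xs
  with lookup s x ≟ lookup ρ x
... | no ¬collision = s , s-alt , s-fixed , ¬collision ∷ s-fine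
... | yes collision =
  repaired , repaired-alt , s-fixed ∘ no-new-fixedPoints
           , resolved ∷ All.map (_∘ no-new-collisions) s-fine
  where open Repair (repair ρ s x n≥6 ρ-perm s-alt collision)

avoiding-alt : ∀ {n} (ρ s₀ : Map n) → 6 ≤ n → IsPerm ρ → IsAlt s₀ →
  ∃ λ s → IsAlt s × FixedPoint s ⊆ FixedPoint s₀ × Avoids ρ s
avoiding-alt {n} ρ s₀ n≥6 ρ-perm s₀-alt
  with s , s-alt , s-fixed , s-fine ← remove-collisions ρ s₀ n≥6 ρ-perm s₀-alt (allFin n)
  = s , s-alt , s-fixed , λ x → All.lookup s-fine (∈-allFin x)

-- Applied first to ρ = s₀ = identity, which yields an even derangement d, and then to
-- ρ with s₀ = d.
even-derangement-avoiding-large : ∀ {n} (ρ : Map n) → 6 ≤ n → IsPerm ρ →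
                                  ∃ λ s → InE s × Avoids ρ s
even-derangement-avoiding-large ρ n≥6 ρ-perm =
  let d , d-alt , _ , d-avoids-identity =
        avoiding-alt identity identity n≥6 identity-perm identity-alt
      s , s-alt , s-fixed , s-avoids = avoiding-alt ρ d n≥6 ρ-perm d-alt
  in s , (s-alt , λ i → avoids-identity⇒derangement d d-avoids-identity i ∘ s-fixed) , s-avoids

isPerm? : ∀ {n} (σ : Map n) → Dec (IsPerm σ)
isPerm? σ = all? λ i → all? λ j → (lookup σ i ≟ lookup σ j) →-dec (i ≟ j)

inE? : ∀ {n} (σ : Map n) → Dec (InE σ)
inE? σ = (isPerm? σ ×-dec 2 ∣? inversions σ) ×-dec all? (λ i → ¬? (lookup σ i ≟ i))

avoids? : ∀ {n} (ρ s : Map n) → Dec (Avoids ρ s)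
avoids? ρ s = all? λ x → ¬? (lookup s x ≟ lookup ρ x)

∀-vec? : ∀ {m k} {P : Vec (Fin m) k → Set} → (∀ v → Dec (P v)) → Dec (∀ v → P v)
∀-vec? {k = zero}  P? = map′ (λ p → λ { [] → p }) (λ p → p []) (P? [])
∀-vec? {k = suc k} P? = map′ (λ p → λ { (x ∷ v) → p x v }) (λ p x v → p (x ∷ v))
                             (all? λ x → ∀-vec? λ v → P? (x ∷ v))

-- Seven 5-cycles which between them avoid every permutation of Fin 5.
fiveCycles : List (Map 5)
fiveCycles =
  (1F ∷ 2F ∷ 3F ∷ 4F ∷ 0F ∷ []) ∷
  (1F ∷ 2F ∷ 4F ∷ 0F ∷ 3F ∷ []) ∷
  (1F ∷ 3F ∷ 0F ∷ 4F ∷ 2F ∷ []) ∷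
  (2F ∷ 0F ∷ 3F ∷ 4F ∷ 1F ∷ []) ∷
  (2F ∷ 0F ∷ 4F ∷ 1F ∷ 3F ∷ []) ∷
  (2F ∷ 3F ∷ 4F ∷ 0F ∷ 1F ∷ []) ∷
  (4F ∷ 2F ∷ 3F ∷ 0F ∷ 1F ∷ []) ∷
  []

-- Checked by evaluating the decision procedure over all 5⁵ maps ρ.
even-derangement-avoiding-five : (ρ : Map 5) → IsPerm ρ → ∃ λ s → InE s × Avoids ρ s
even-derangement-avoiding-five ρ ρ-perm = Any.satisfied (search ρ ρ-perm)
  where
  search : ∀ ρ → IsPerm ρ → Any.Any (λ s → InE s × Avoids ρ s) fiveCycles
  search = toWitness {a? = ∀-vec? λ ρ → isPerm? ρ →-dec
                                  Any.any? (λ s → inE? s ×-dec avoids? ρ s) fiveCycles} _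

even-derangement-avoiding : ∀ {n} (ρ : Map n) → 5 ≤ n → IsPerm ρ → ∃ λ s → InE s × Avoids ρ s
even-derangement-avoiding ρ n≥5 with m≤n⇒m<n∨m≡n n≥5
... | inj₁ n≥6  = even-derangement-avoiding-large ρ n≥6
... | inj₂ refl = even-derangement-avoiding-five ρ

-- If the even derangement s avoids ρ ∈ A_n, then ρ s⁻¹ is an even derangement:
-- a fixed point i of ρ s⁻¹ would give s(i) = ρ(i).
quotient-even-derangement : ∀ {n} (ρ s : Map n) (s-perm : IsPerm s) →
  IsAlt ρ → IsAlt s → Avoids ρ s → InE (divide ρ s s-perm)
quotient-even-derangement ρ s s-perm ρ-alt s-alt s-avoids = quotient-alt , quotient-derangement
  where
  q = divide ρ s s-perm
  quotient-alt : IsAlt q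
  quotient-alt = alt-cancelʳ q s s-alt (subst IsAlt (sym (divide-· ρ s s-perm)) ρ-alt)
  quotient-derangement : IsDerangement q
  quotient-derangement i fixed = s-avoids i (begin
    lookup s i             ≡⟨ cong (lookup s) fixed ⟨
    lookup s (lookup q i)  ≡⟨ lookup-· q s i ⟨
    lookup (q · s) i       ≡⟨ cong (λ t → lookup t i) (divide-· ρ s s-perm) ⟩
    lookup ρ i             ∎)

alt-product-of-two : ∀ {n} (ρ : Map n) → 5 ≤ n → IsAlt ρ →
                     ∃₂ λ s₁ s₂ → InE s₁ × InE s₂ × s₂ · s₁ ≡ ρ
alt-product-of-two ρ n≥5 ρ-alt@(ρ-perm , _) =
  let s₁ , s₁-E@(s₁-alt@(s₁-perm , _) , _) , s₁-avoids = even-derangement-avoiding ρ n≥5 ρ-perm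
  in s₁ , divide ρ s₁ s₁-perm , s₁-E
        , quotient-even-derangement ρ s₁ s₁-perm ρ-alt s₁-alt s₁-avoids , divide-· ρ s₁ s₁-perm

distance-two : ∀ {n} (σ τ : Map n) → 5 ≤ n → IsAlt σ → IsAlt τ → ∃ λ w → AGAdj σ w × AGAdj w τ
distance-two σ τ n≥5 σ-alt@(σ-perm , _) τ-alt =
  let s₁ , s₂ , s₁-E , s₂-E , s₂·s₁≡ρ = alt-product-of-two ρ n≥5 ρ-alt
  in s₁ · σ , (s₁ , s₁-E , inj₁ refl) , (s₂ , s₂-E , inj₁ (via s₁ s₂ s₂·s₁≡ρ))
  where
  ρ = divide τ σ σ-perm
  ρ-alt : IsAlt ρ
  ρ-alt = alt-cancelʳ ρ σ σ-alt (subst IsAlt (sym (divide-· τ σ σ-perm)) τ-alt)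
  via : ∀ s₁ s₂ → s₂ · s₁ ≡ ρ → τ ≡ s₂ · (s₁ · σ)
  via s₁ s₂ s₂·s₁≡ρ = begin
    τ              ≡⟨ divide-· τ σ σ-perm ⟨
    ρ · σ          ≡⟨ cong (_· σ) s₂·s₁≡ρ ⟨
    (s₂ · s₁) · σ  ≡⟨ ·-assoc s₂ s₁ σ ⟩
    s₂ · (s₁ · σ)  ∎

-- Adjacent permutations differ at every point, since the connecting element of ℰ_n
-- has no fixed point.
adjacent⇒disagree : ∀ {n} (g h : Map n) → IsPerm g → IsPerm h → AGAdj g h →
                    ∀ i → lookup g i ≢ lookup h i
adjacent⇒disagree g _ g-perm h-perm (s , (_ , s-moves) , inj₁ refl) i eq =
  s-moves i (g-perm _ _ (sym (trans eq (lookup-· s g i))))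
adjacent⇒disagree _ h g-perm h-perm (s , (_ , s-moves) , inj₂ refl) i eq =
  s-moves i (h-perm _ _ (trans (sym (lookup-· s h i)) eq))

-- (0 1 2) and (0 2 1) are even, differ at 0 and agree at 3.
far-pair : ∀ {n} → 4 ≤ n → ∃₂ λ (u v : Map n) → IsAlt u × IsAlt v × u ≢ v × ¬ AGAdj u v
far-pair (s≤s (s≤s (s≤s (s≤s _)))) =
  u , v , u-alt , v-alt , differ-at-0 ,
  λ adj → adjacent⇒disagree u v (proj₁ u-alt) (proj₁ v-alt) adj 3F refl
  where
  u = threeCycle 0F 1F 2F
  v = threeCycle 0F 2F 1F
  u-alt : IsAlt u
  u-alt = threeCycle-alt 0F 1F 2F ((λ ()) , (λ ()) , (λ ()))
  v-alt : IsAlt v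
  v-alt = threeCycle-alt 0F 2F 1F ((λ ()) , (λ ()) , (λ ()))
  differ-at-0 : u ≢ v
  differ-at-0 eq with () ← cong (λ t → lookup t 0F) eq

Tensor : ∀ {A : Set} → (A → A → Set) → ∀ q → Vec A q → Vec A q → Set
Tensor R q x y = ∀ k → R (lookup x k) (lookup y k)

tensor-midpoint : ∀ {A : Set} {R : A → A → Set} {q} (u v : Vec A q) →
  (∀ k → ∃ λ w → R (lookup u k) w × R w (lookup v k)) →
  ∃ λ W → Tensor R q u W × Tensor R q W v
tensor-midpoint {R = R} u v mid =
  W , (λ k → subst (R _) (sym (lookup∘tabulate _ k)) (proj₁ (proj₂ (mid k))))
    , (λ k → subst (λ t → R t _) (sym (lookup∘tabulate _ k)) (proj₂ (proj₂ (mid k))))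
  where
  W = tabulate (proj₁ ∘ mid)

walk-length-0 : ∀ {V : Set} {R : V → V → Set} {u v : V} → Walk R u v 0 → u ≡ v
walk-length-0 nil = refl

walk-length-1 : ∀ {V : Set} {R : V → V → Set} {u v : V} → Walk R u v 1 → R u v
walk-length-1 (cons u~v nil) = u~v

constant-tuples-far : ∀ {A : Set} {R : A → A → Set} {u v : A} q → 1 ≤ q → u ≢ v → ¬ R u v →
  ∀ k → k < 2 → ¬ Walk (Tensor R q) (replicate q u) (replicate q v) k
constant-tuples-far (suc q) _ u≢v _ zero _ walk =
  u≢v (cong (λ t → lookup t 0F) (walk-length-0 walk))
constant-tuples-far (suc q) _ _ u≁v (suc zero) _ walk = u≁v (walk-length-1 walk 0F)
constant-tuples-far q _ _ _ (suc (suc k)) (s≤s (s≤s ())) _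

theorem2p6 : ∀ (n q : ℕ) → 5 ≤ n → 1 ≤ q → HasDiameter (AltTuple n q) (AGqAdj n q) 2
theorem2p6 n q n≥5 q≥1 = upper , lower
  where
  upper : ∀ u v → AltTuple n q u → AltTuple n q v → ∃[ k ] (k ≤ 2 × Walk (AGqAdj n q) u v k)
  upper u v u-alt v-alt =
    let W , u~W , W~v = tensor-midpoint {R = AGAdj {n}} u v
                          (λ k → distance-two (lookup u k) (lookup v k) n≥5 (u-alt k) (v-alt k))
    in 2 , ≤-refl , cons {w = W} u~W (cons W~v nil)
  lower : ∃[ u ] ∃[ v ] (AltTuple n q u × AltTuple n q v ×
                         (∀ k → k < 2 → ¬ Walk (AGqAdj n q) u v k))
  lower =
    let a , b , a-alt , b-alt , a≢b , a≁b = far-pair {n} (<⇒≤ n≥5)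
    in replicate q a , replicate q b
     , (λ k → subst IsAlt (sym (lookup-replicate k a)) a-alt)
     , (λ k → subst IsAlt (sym (lookup-replicate k b)) b-alt)
     , constant-tuples-far {R = AGAdj {n}} q q≥1 a≢b a≁b
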